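{- Let $n$, $k$, $t$ and $s$ be positive integers with $k\geq t+2$ and $n\geq 2(t+1)\left((k-t+1)^{2}+s\right)$. For positive integers $x$ define $$f(n,k,t,s,x)= (k-t+1)^{x-t}\binom{x}{t}\binom{n-x}{k-x}+\sum_{i=0}^{x-t-1}s(k-t+1)^{i}\binom{x}{t}.$$ Then $f(n,k,t,s,x)>f(n,k,t,s,x+1)$ for every $x\in\{t+1,t+2,\ldots,k-1\}$. -}

module Defs where

open import Data.Nat using (ℕ; zero; suc; _+_; _*_; _∸_; _^_)
open import Data.Nat.Combinatorics using (_C_)

sumBelow : ℕ → (ℕ → ℕ) → ℕ
sumBelow zero    g = 0
sumBelow (suc m) g = sumBelow m g + g m

-- f(n,k,t,s,x) = (k-t+1)^(x-t) C(x,t) C(n-x,k-x) + Σ_{i=0}^{x-t-1} s (k-t+1)^i C(x,t)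
-- (truncated subtraction is only used where x ≥ t, k ≥ x, n ≥ x in the lemma)
f : ℕ → ℕ → ℕ → ℕ → ℕ → ℕ
f n k t s x =
  (k ∸ t + 1) ^ (x ∸ t) * (x C t) * ((n ∸ x) C (k ∸ x))
  + sumBelow (x ∸ t) (λ i → s * (k ∸ t + 1) ^ i * (x C t))

{-# OPTIONS --safe #-}
-- Put q = k - t + 1, d = x - t, N = n - x, j = k - x and G_d = Σ_{i<d} q^i, so that
-- f(x) = C(x,t) (q^d C(N,j) + s G_d).  Passing from x to x + 1 multiplies C(x,t) by
-- (x+1)/(d+1) ≤ t + 1, multiplies C(N,j) by j/N, and adds s q^d to s G_d.  Since
-- G_d ≤ q^d, j ≤ q and C(N,j) ≥ N, clearing the denominators (d+1) N reduces the
-- claim to (t+1)(q² + s) < N, which holds because x < k ≤ (t+1)(q² + s) and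
-- n ≥ 2 (t+1)(q² + s).
module Submission where

open import Defs
open import Data.Nat using (ℕ; zero; suc; _+_; _*_; _∸_; _^_; _≤_; _<_; _>_; z≤n; s≤s; >-nonZero)
open import Data.Nat.Properties
open import Data.Nat.Combinatorics using (_C_; nC1≡n; nCk≡nC[n∸k]; k>n⇒nCk≡0; nCk+nC[k+1]≡[n+1]C[k+1])
open import Data.Nat.Tactic.RingSolver using (solve; solve-∀)
open import Data.List using (_∷_; [])
open import Relation.Binary.PropositionalEquality

[m+n]Cm≡[m+n]Cn : ∀ m n → (m + n) C m ≡ (m + n) C n
[m+n]Cm≡[m+n]Cn m n = trans (nCk≡nC[n∸k] (m≤m+n m n)) (cong ((m + n) C_) (m+n∸m≡n m n))

[k+1]*[n+1]C[k+1]≡[n+1]*nCk : ∀ n k → suc k * (suc n C suc k) ≡ suc n * (n C k)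
[k+1]*[n+1]C[k+1]≡[n+1]*nCk n zero =
  trans (+-identityʳ (suc n C 1)) (trans (nC1≡n (suc n)) (sym (*-identityʳ (suc n))))
[k+1]*[n+1]C[k+1]≡[n+1]*nCk zero (suc k)
  rewrite k>n⇒nCk≡0 {1} {suc (suc k)} (s≤s (s≤s z≤n)) | k>n⇒nCk≡0 {0} {suc k} (s≤s z≤n) =
  *-zeroʳ (suc (suc k))
[k+1]*[n+1]C[k+1]≡[n+1]*nCk (suc n) (suc k) = begin
    suc K * (suc m C suc K)
  ≡⟨ cong (suc K *_) (nCk+nC[k+1]≡[n+1]C[k+1] m K) ⟨
    suc K * (m C K + m C suc K)
  ≡⟨ *-distribˡ-+ (suc K) (m C K) (m C suc K) ⟩
    m C K + K * (m C K) + suc K * (m C suc K)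
  ≡⟨ +-assoc (m C K) (K * (m C K)) (suc K * (m C suc K)) ⟩
    m C K + (K * (m C K) + suc K * (m C suc K))
  ≡⟨ cong (m C K +_) (cong₂ _+_ ([k+1]*[n+1]C[k+1]≡[n+1]*nCk n k) ([k+1]*[n+1]C[k+1]≡[n+1]*nCk n K)) ⟩
    m C K + (m * (n C k) + m * (n C K))
  ≡⟨ cong (m C K +_) (*-distribˡ-+ m (n C k) (n C K)) ⟨
    m C K + m * (n C k + n C K)
  ≡⟨ cong (λ c → m C K + m * c) (nCk+nC[k+1]≡[n+1]C[k+1] n k) ⟩
    m C K + m * (m C K)
  ∎
  where
  open ≡-Reasoning
  m = suc n
  K = suc k

[d+1]*[t+d+1]Ct≡[t+d+1]*[t+d]Ct : ∀ t d → suc d * ((t + suc d) C t) ≡ (t + suc d) * ((t + d) C t)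
[d+1]*[t+d+1]Ct≡[t+d+1]*[t+d]Ct t d = begin
    suc d * ((t + suc d) C t)
  ≡⟨ cong (suc d *_) ([m+n]Cm≡[m+n]Cn t (suc d)) ⟩
    suc d * ((t + suc d) C suc d)
  ≡⟨ cong (λ m → suc d * (m C suc d)) (+-suc t d) ⟩
    suc d * (suc (t + d) C suc d)
  ≡⟨ [k+1]*[n+1]C[k+1]≡[n+1]*nCk (t + d) d ⟩
    suc (t + d) * ((t + d) C d)
  ≡⟨ cong₂ _*_ (+-suc t d) ([m+n]Cm≡[m+n]Cn t d) ⟨
    (t + suc d) * ((t + d) C t)
  ∎
  where open ≡-Reasoning

k≤n⇒nCk>0 : ∀ {n k} → k ≤ n → n C k > 0
k≤n⇒nCk>0 {n} {zero} _ = s≤s z≤n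
k≤n⇒nCk>0 {suc n} {suc k} (s≤s k≤n) =
  ≤-trans (k≤n⇒nCk>0 k≤n)
    (subst (n C k ≤_) (nCk+nC[k+1]≡[n+1]C[k+1] n k) (m≤m+n (n C k) (n C suc k)))

k<n⇒[n+1]≤[n+1]C[k+1] : ∀ {n k} → k < n → suc n ≤ suc n C suc k
k<n⇒[n+1]≤[n+1]C[k+1] {n} {zero} _ = ≤-reflexive (sym (nC1≡n (suc n)))
k<n⇒[n+1]≤[n+1]C[k+1] {suc n} {suc k} (s≤s k<n) = begin
    suc (suc n)
  ≡⟨ +-comm 1 (suc n) ⟩
    suc n + 1
  ≤⟨ +-mono-≤ (k<n⇒[n+1]≤[n+1]C[k+1] k<n) (k≤n⇒nCk>0 (s≤s k<n)) ⟩
    suc n C suc k + suc n C suc (suc k)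
  ≡⟨ nCk+nC[k+1]≡[n+1]C[k+1] (suc n) (suc k) ⟩
    suc (suc n) C suc (suc k)
  ∎
  where open ≤-Reasoning

sumBelow-*ˡ : ∀ m c g → sumBelow m (λ i → c * g i) ≡ c * sumBelow m g
sumBelow-*ˡ zero    c g = sym (*-zeroʳ c)
sumBelow-*ˡ (suc m) c g =
  trans (cong (_+ c * g m) (sumBelow-*ˡ m c g)) (sym (*-distribˡ-+ c (sumBelow m g) (g m)))

sumBelow-*ʳ : ∀ m c g → sumBelow m (λ i → g i * c) ≡ sumBelow m g * c
sumBelow-*ʳ zero    c g = refl
sumBelow-*ʳ (suc m) c g =
  trans (cong (_+ g m * c) (sumBelow-*ʳ m c g)) (sym (*-distribʳ-+ c (sumBelow m g) (g m)))

sumBelow-pow≤pow : ∀ {q} m → 2 ≤ q → sumBelow m (q ^_) ≤ q ^ m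
sumBelow-pow≤pow     zero    _   = z≤n
sumBelow-pow≤pow {q} (suc m) q≥2 = begin
    sumBelow m (q ^_) + q ^ m
  ≤⟨ +-monoˡ-≤ (q ^ m) (sumBelow-pow≤pow m q≥2) ⟩
    q ^ m + q ^ m
  ≡⟨ cong (q ^ m +_) (+-identityʳ (q ^ m)) ⟨
    2 * q ^ m
  ≤⟨ *-monoˡ-≤ (q ^ m) q≥2 ⟩
    q * q ^ m
  ∎
  where open ≤-Reasoning

F : ℕ → ℕ → ℕ → ℕ → ℕ → ℕ
F q s t d c = ((t + d) C t) * (q ^ d * c + s * sumBelow d (q ^_))

f≡F : ∀ n k t s {x} → t ≤ x → f n k t s x ≡ F (k ∸ t + 1) s t (x ∸ t) ((n ∸ x) C (k ∸ x))
f≡F n k t s {x} t≤x = begin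
    q ^ d * a * c + sumBelow d (λ i → s * q ^ i * a)
  ≡⟨ cong (q ^ d * a * c +_) (trans (sumBelow-*ʳ d a (λ i → s * q ^ i)) (cong (_* a) (sumBelow-*ˡ d s (q ^_)))) ⟩
    q ^ d * a * c + s * sumBelow d (q ^_) * a
  ≡⟨ factor (q ^ d) a c (s * sumBelow d (q ^_)) ⟩
    a * (q ^ d * c + s * sumBelow d (q ^_))
  ≡⟨ cong (λ y → (y C t) * (q ^ d * c + s * sumBelow d (q ^_))) (m+[n∸m]≡n t≤x) ⟨
    F q s t d c
  ∎
  where
  open ≡-Reasoning
  q = k ∸ t + 1
  d = x ∸ t
  a = x C t
  c = (n ∸ x) C (k ∸ x)
  factor : ∀ Q a c S → Q * a * c + S * a ≡ a * (Q * c + S)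
  factor = solve-∀

[t+1][qjb+sN]<Nb : ∀ {q s t j N b} → j ≤ q → N ≤ b → (t + 1) * (q * q + s) < N →
                   (t + 1) * (q * j * b + s * N) < N * b
[t+1][qjb+sN]<Nb {q} {s} {t} {j} {N} {b} j≤q N≤b M<N = begin-strict
    (t + 1) * (q * j * b + s * N)
  ≤⟨ *-monoʳ-≤ (t + 1) (+-mono-≤ (*-monoˡ-≤ b (*-monoʳ-≤ q j≤q)) (*-monoʳ-≤ s N≤b)) ⟩
    (t + 1) * (q * q * b + s * b)
  ≡⟨ solve (q ∷ s ∷ t ∷ b ∷ []) ⟩
    b * ((t + 1) * (q * q + s))
  <⟨ *-monoʳ-< b {{>-nonZero (<-≤-trans (≤-<-trans z≤n M<N) N≤b)}} M<N ⟩
    b * N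
  ≡⟨ *-comm b N ⟩
    N * b
  ∎
  where open ≤-Reasoning

t+t+P≤[t+1]*P : ∀ t {P} → 2 ≤ P → t + t + P ≤ (t + 1) * P
t+t+P≤[t+1]*P t {P} P≥2 = begin
    t + t + P
  ≡⟨ solve (t ∷ P ∷ []) ⟩
    t * 2 + P
  ≤⟨ +-monoˡ-≤ P (*-monoʳ-≤ t P≥2) ⟩
    t * P + P
  ≡⟨ solve (t ∷ P ∷ []) ⟩
    (t + 1) * P
  ∎
  where open ≤-Reasoning

-- The claim f(x+1) < f(x) multiplied by (d+1) N / C(x,t), where P = d + 1, Q = q^d, G = G_d, b = C(N,j).
cleared-step< : ∀ {q s t P N j Q G b} → 2 ≤ P → Q > 0 → G ≤ Q →
                (t + 1) * (q * j * b + s * N) < N * b →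
                (t + P) * (q * Q * (j * b) + s * N * (G + Q)) < P * N * (Q * b + s * G)
cleared-step< {q} {s} {t} {P} {N} {j} {Q} {G} {b} P≥2 Q>0 G≤Q key = begin-strict
    (t + P) * (q * Q * (j * b) + s * N * (G + Q))
  ≡⟨ solve (q ∷ s ∷ t ∷ P ∷ N ∷ j ∷ Q ∷ G ∷ b ∷ []) ⟩
    (t + P) * Q * (q * j * b + s * N) + t * (s * N) * G + P * (s * N * G)
  ≤⟨ +-monoˡ-≤ (P * (s * N * G)) (+-monoʳ-≤ ((t + P) * Q * (q * j * b + s * N)) (*-mono-≤ (*-monoʳ-≤ t (m≤n+m (s * N) (q * j * b))) G≤Q)) ⟩
    (t + P) * Q * (q * j * b + s * N) + t * (q * j * b + s * N) * Q + P * (s * N * G)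
  ≡⟨ solve (q ∷ s ∷ t ∷ P ∷ N ∷ j ∷ Q ∷ G ∷ b ∷ []) ⟩
    (t + t + P) * (Q * (q * j * b + s * N)) + P * (s * N * G)
  ≤⟨ +-monoˡ-≤ (P * (s * N * G)) (*-monoˡ-≤ (Q * (q * j * b + s * N)) (t+t+P≤[t+1]*P t P≥2)) ⟩
    (t + 1) * P * (Q * (q * j * b + s * N)) + P * (s * N * G)
  ≡⟨ solve (q ∷ s ∷ t ∷ P ∷ N ∷ j ∷ Q ∷ G ∷ b ∷ []) ⟩
    P * Q * ((t + 1) * (q * j * b + s * N)) + P * (s * N * G)
  <⟨ +-monoˡ-< (P * (s * N * G)) (*-monoʳ-< (P * Q) {{>-nonZero (*-mono-≤ (<-trans 0<1+n P≥2) Q>0)}} key) ⟩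
    P * Q * (N * b) + P * (s * N * G)
  ≡⟨ solve (q ∷ s ∷ t ∷ P ∷ N ∷ j ∷ Q ∷ G ∷ b ∷ []) ⟩
    P * N * (Q * b + s * G)
  ∎
  where open ≤-Reasoning

step<-from-ratios : ∀ {q s t P N j Q G a a′ b b′} → 2 ≤ P → a > 0 → Q > 0 → G ≤ Q →
                    P * a′ ≡ (t + P) * a → N * b′ ≡ j * b →
                    (t + 1) * (q * j * b + s * N) < N * b →
                    a′ * (q * Q * b′ + s * (G + Q)) < a * (Q * b + s * G)
step<-from-ratios {q} {s} {t} {P} {N} {j} {Q} {G} {a} {a′} {b} {b′} P≥2 a>0 Q>0 G≤Q Pa′≡[t+P]a Nb′≡jb key =
  *-cancelˡ-< (P * N) _ _ (begin-strict
    P * N * (a′ * (q * Q * b′ + s * (G + Q)))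
  ≡⟨ solve (q ∷ s ∷ P ∷ N ∷ Q ∷ G ∷ a′ ∷ b′ ∷ []) ⟩
    P * a′ * (q * Q * (N * b′) + s * N * (G + Q))
  ≡⟨ cong₂ (λ x y → x * (q * Q * y + s * N * (G + Q))) Pa′≡[t+P]a Nb′≡jb ⟩
    (t + P) * a * (q * Q * (j * b) + s * N * (G + Q))
  ≡⟨ solve (q ∷ s ∷ t ∷ P ∷ N ∷ j ∷ Q ∷ G ∷ a ∷ b ∷ []) ⟩
    a * ((t + P) * (q * Q * (j * b) + s * N * (G + Q)))
  <⟨ *-monoʳ-< a {{>-nonZero a>0}} (cleared-step< {q} {s} {t} {j = j} P≥2 Q>0 G≤Q key) ⟩
    a * (P * N * (Q * b + s * G))
  ≡⟨ solve (s ∷ P ∷ N ∷ Q ∷ G ∷ a ∷ b ∷ []) ⟩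
    P * N * (a * (Q * b + s * G))
  ∎)
  where open ≤-Reasoning

F-suc<F : ∀ {q s t d N j} → 2 ≤ q → 1 ≤ d → 0 < j → j ≤ q → j < N → (t + 1) * (q * q + s) < N →
          F q s t (suc d) ((N ∸ 1) C (j ∸ 1)) < F q s t d (N C j)
F-suc<F {q} {s} {t} {d} {suc m} {suc i} q≥2 d≥1 _ j≤q (s≤s i<m) M<N =
  step<-from-ratios {q} {s} {t} {N = suc m} {j = suc i} (s≤s d≥1) (k≤n⇒nCk>0 (m≤m+n t d)) (m^n>0 q {{>-nonZero (<-trans 0<1+n q≥2)}} d)
    (sumBelow-pow≤pow d q≥2)
    ([d+1]*[t+d+1]Ct≡[t+d+1]*[t+d]Ct t d) (sym ([k+1]*[n+1]C[k+1]≡[n+1]*nCk m i))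
    ([t+1][qjb+sN]<Nb {q} {s} {t} j≤q (k<n⇒[n+1]≤[n+1]C[k+1] i<m) M<N)

t+r≤[t+1]*[[r+1]*[r+1]+s] : ∀ t r s → t + r ≤ (t + 1) * ((r + 1) * (r + 1) + s)
t+r≤[t+1]*[[r+1]*[r+1]+s] t r s = begin
    t + r
  ≤⟨ m≤m+n (t + r) (1 + r + s + r * r + t * (r * r + r + r + s)) ⟩
    t + r + (1 + r + s + r * r + t * (r * r + r + r + s))
  ≡⟨ solve (t ∷ r ∷ s ∷ []) ⟩
    (t + 1) * ((r + 1) * (r + 1) + s)
  ∎
  where open ≤-Reasoning

M<n∸x : ∀ {M n x} → x < M → 2 * M ≤ n → M < n ∸ x
M<n∸x {M} {n} {x} x<M 2M≤n = m+n≤o⇒m≤o∸n (suc M) (begin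
    suc M + x
  ≡⟨ +-suc M x ⟨
    M + suc x
  ≤⟨ +-monoʳ-≤ M x<M ⟩
    M + M
  ≡⟨ cong (M +_) (+-identityʳ M) ⟨
    2 * M
  ≤⟨ 2M≤n ⟩
    n
  ∎)
  where open ≤-Reasoning

lemma2p2 : (n k t s : ℕ) → 1 ≤ n → 1 ≤ k → 1 ≤ t → 1 ≤ s →
    t + 2 ≤ k →
    2 * (t + 1) * ((k ∸ t + 1) ^ 2 + s) ≤ n →
    (x : ℕ) → t + 1 ≤ x → x ≤ k ∸ 1 →
    f n k t s x > f n k t s (x + 1)
-- k ≥ t + 2 already follows from t + 1 ≤ x ≤ k - 1, and n, t, s may as well be 0.
lemma2p2 n k t s _ k≥1 _ _ _ n-large x t+1≤x x≤k∸1 = begin-strict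
    f n k t s (x + 1)
  ≡⟨ f≡F n k t s (≤-trans t≤x (m≤m+n x 1)) ⟩
    F q s t (x + 1 ∸ t) ((n ∸ (x + 1)) C (k ∸ (x + 1)))
  ≡⟨ cong₂ (F q s t) x+1∸t≡1+[x∸t] (cong₂ _C_ (sym (∸-+-assoc n x 1)) (sym (∸-+-assoc k x 1))) ⟩
    F q s t (suc (x ∸ t)) ((n ∸ x ∸ 1) C (k ∸ x ∸ 1))
  <⟨ F-suc<F {s = s} {t} q≥2 (m<n⇒0<n∸m t<x) (m<n⇒0<n∸m x<k) j≤q j<N M<N ⟩
    F q s t (x ∸ t) ((n ∸ x) C (k ∸ x))
  ≡⟨ f≡F n k t s t≤x ⟨
    f n k t s x
  ∎
  where
  open ≤-Reasoning
  q = k ∸ t + 1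
  M = (t + 1) * (q * q + s)
  t<x : t < x
  t<x = subst (_≤ x) (+-comm t 1) t+1≤x
  t≤x : t ≤ x
  t≤x = <⇒≤ t<x
  x<k : x < k
  x<k = ≤-trans (s≤s x≤k∸1) (≤-reflexive (m+[n∸m]≡n k≥1))
  q≥2 : 2 ≤ q
  q≥2 = +-monoˡ-≤ 1 (m<n⇒0<n∸m (<-trans t<x x<k))
  x+1∸t≡1+[x∸t] : x + 1 ∸ t ≡ suc (x ∸ t)
  x+1∸t≡1+[x∸t] = trans (+-∸-comm 1 t≤x) (+-comm (x ∸ t) 1)
  k≤M : k ≤ M
  k≤M = ≤-trans (m≤n+m∸n k t) (t+r≤[t+1]*[[r+1]*[r+1]+s] t (k ∸ t) s)
  2M≤n : 2 * M ≤ n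
  2M≤n = subst (_≤ n) (trans (*-assoc 2 (t + 1) _) (cong (λ y → 2 * ((t + 1) * (q * y + s))) (*-identityʳ q))) n-large
  M<N : M < n ∸ x
  M<N = M<n∸x (<-≤-trans x<k k≤M) 2M≤n
  j≤q : k ∸ x ≤ q
  j≤q = ≤-trans (∸-monoʳ-≤ k t≤x) (m≤m+n (k ∸ t) 1)
  j<N : k ∸ x < n ∸ x
  j<N = ∸-monoˡ-< (≤-<-trans k≤M (<-≤-trans M<N (m∸n≤m n x))) (<⇒≤ x<k)
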